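{- Let $G$ be a graph with $e(G)\leq 4v(G)-1$ and $\delta(G)\geq 4$. Then at least one of the following occurs in $G$: (C1) a $4$-vertex adjacent to a $19^-$-vertex; (C2) a $5$-vertex adjacent to two $19^-$-vertices; (C3) a $6$-vertex adjacent to four $19^-$-vertices; (C4) a $7$-vertex adjacent to six $19^-$-vertices; (C5) a vertex $v$ with $20\leq d(v)\leq 22$ such that at least $d(v)-3$ of its neighbors are $7^-$-vertices; (C6) a vertex $v$ with $23\leq d(v)\leq 25$ such that at least $d(v)-2$ of its neighbors are $7^-$-vertices; (C7) a vertex $v$ with $26\leq d(v)\leq 28$ such that at least $d(v)-1$ of its neighbors are $7^-$-vertices; (C8) a vertex $v$ with $29\leq d(v)\leq 31$ all of whose neighbors are $7^-$-vertices; (C9) a vertex $v$ such that at least $d(v)-7$ of its neighbors are $7^-$-vertices and at least one of these neighbors has degree $4$.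
   Context: All graphs are finite, simple and undirected; $v(G)=|V(G)|$, $e(G)=|E(G)|$, $\delta(G)$ is the minimum degree, $d(v)$ is the degree of $v$. A $k$-vertex (resp. $k^-$-vertex) is a vertex of degree exactly $k$ (resp. at most $k$). -}

module Defs where

open import Data.Bool using (Bool; true; false; T)
open import Data.Nat using (ℕ; _≤_; _<_; _≤?_; _<?_)
open import Data.Fin using (Fin; toℕ)
open import Data.List using (List; length; filter; cartesianProduct)
open import Data.Fin.Base using () 
open import Data.List.Base using ()
open import Data.Product using (_×_; _,_; proj₁; proj₂)
open import Relation.Binary.PropositionalEquality using (_≡_)
open import Relation.Nullary.Decidable using (T?; _×-dec_)
open import Data.Fin.Base using (Fin)
import Data.List.Base as L
import Data.Fin.Base as F

record Graph : Set where
  field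
    n      : ℕ
    adj    : Fin n → Fin n → Bool
    sym    : ∀ i j → adj i j ≡ adj j i
    irrefl : ∀ i → adj i i ≡ false

open Graph public

allV : (G : Graph) → List (Fin (n G))
allV G = L.tabulate (λ i → i)

vG : Graph → ℕ
vG G = n G

Adj : (G : Graph) → Fin (n G) → Fin (n G) → Set
Adj G u v = T (adj G u v)

deg : (G : Graph) → Fin (n G) → ℕ
deg G v = length (filter (λ w → T? (adj G v w)) (allV G))

eG : Graph → ℕ
eG G = length (filter (λ p → T? (adj G (proj₁ p) (proj₂ p)) ×-dec (toℕ (proj₁ p) <? toℕ (proj₂ p)))
                      (cartesianProduct (allV G) (allV G)))

MinDegAtLeast : Graph → ℕ → Set
MinDegAtLeast G k = ∀ v → k ≤ deg G v

nbrsDegAtMost : (G : Graph) → Fin (n G) → ℕ → ℕ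
nbrsDegAtMost G v k =
  length (filter (λ w → T? (adj G v w) ×-dec (deg G w ≤? k)) (allV G))

-- Discharging. Give every vertex charge 12 d(v); the total 24 e(G) is less than 96 v(G).
-- Every 20⁺-vertex sends 12, 9, 8, 6 to each neighbour of degree 4, 5, 6, 7 respectively.
-- Without (C1)–(C9) every vertex ends with charge at least 96: a 4-, 5-, 6-, 7-vertex has
-- at least 4, 4, 3, 2 neighbours of degree ≥ 20; a vertex of degree 8 to 19 keeps 12 d ≥ 96;
-- a 20⁺-vertex with a 4-neighbour sends 12 to at most d − 8 neighbours by (C9), and one
-- without sends at most 9 to each 7⁻-neighbour, of which (C5)–(C8) leave few enough.
-- Since charge is conserved, this contradicts the total.
module Submission where

open import Defs
open import Data.Nat using (ℕ; _≤_; _+_; _*_; _∸_)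
open import Data.Fin using (Fin)
open import Data.Product using (Σ; ∃; _×_; _,_)
open import Data.Sum using (_⊎_)
open import Relation.Binary.PropositionalEquality using (_≡_)

open import Data.Bool using (if_then_else_)
open import Data.Nat using (zero; suc; z≤n; s≤s; _<_; _≤?_; _<?_; _≟_)
open import Data.Nat.Properties
open import Data.Nat.Tactic.RingSolver using (solve-∀)
open import Data.Fin using (zero; suc; toℕ)
open import Data.Fin.Properties using (any?; toℕ-injective)
open import Data.Product using (proj₁; proj₂)
open import Data.Sum using (map₂)
open import Data.List using (_++_; map; length; filter; tabulate; cartesianProduct)
open import Data.List.Properties using (length-++; filter-++; map-tabulate)
open import Algebra.Properties.Semiring.Sum +-*-semiring
  using (sum-syntax; ∑-distrib-+; ∑-comm; *-distribˡ-sum; sum-cong-≗)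
open import Relation.Nullary using (Dec; yes; no; ¬_; does)
open import Relation.Nullary.Decidable using (T?; _×-dec_; decidable-stable; toSum)
open import Relation.Unary using (Pred; Decidable)
open import Relation.Binary using (tri<; tri≈; tri>)
open import Relation.Binary.PropositionalEquality
  using (refl; trans; cong; cong₂; subst; subst₂; module ≡-Reasoning)
  renaming (sym to ≡-sym)
open import Data.Empty using (⊥; ⊥-elim)
open import Function using (_∘_)

𝟙 : ∀ {p} {P : Set p} → Dec P → ℕ
𝟙 d = if does d then 1 else 0

module _ {p} {P : Set p} where

  𝟙-yes : (d : Dec P) → P → 𝟙 d ≡ 1
  𝟙-yes (yes _) _ = refl
  𝟙-yes (no ¬p) p = ⊥-elim (¬p p)

  𝟙-no : (d : Dec P) → ¬ P → 𝟙 d ≡ 0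
  𝟙-no (yes p) ¬p = ⊥-elim (¬p p)
  𝟙-no (no _) _ = refl

  𝟙≤1 : (d : Dec P) → 𝟙 d ≤ 1
  𝟙≤1 (yes _) = ≤-refl
  𝟙≤1 (no _) = z≤n

  𝟙-positive : (d : Dec P) → 0 < 𝟙 d → P
  𝟙-positive (yes p) _ = p

  𝟙-*-mono : ∀ {x y} c (d : Dec P) → (P → x ≤ c * y) → 𝟙 d * x ≤ c * (𝟙 d * y)
  𝟙-*-mono {x} {y} c (yes p) x≤cy =
    subst₂ _≤_ (≡-sym (+-identityʳ x)) (cong (c *_) (≡-sym (+-identityʳ y))) (x≤cy p)
  𝟙-*-mono c (no _) _ = z≤n

  𝟙-×-dec : ∀ {q} {Q : Set q} (d : Dec P) (e : Dec Q) → 𝟙 (d ×-dec e) ≡ 𝟙 d * 𝟙 e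
  𝟙-×-dec (yes _) (yes _) = refl
  𝟙-×-dec (yes _) (no _) = refl
  𝟙-×-dec (no _) _ = refl

  𝟙-complement : ∀ {q} {Q : Set q} (d : Dec P) (e : Dec Q) →
                 (P → ¬ Q) → (¬ P → Q) → 𝟙 d + 𝟙 e ≡ 1
  𝟙-complement (yes p) (yes q) excl _ = ⊥-elim (excl p q)
  𝟙-complement (yes _) (no _) _ _ = refl
  𝟙-complement (no _) (yes _) _ _ = refl
  𝟙-complement (no ¬p) (no ¬q) _ cover = ⊥-elim (¬q (cover ¬p))

_or-else_ : ∀ {p q} {P : Set p} {Q : Set q} → Dec P → (¬ P → Q) → P ⊎ Q
d or-else k = map₂ k (toSum d)

infixr 0 _or-else_

∑-mono-≤ : ∀ {n} {f g : Fin n → ℕ} → (∀ i → f i ≤ g i) → ∑[ i < n ] f i ≤ ∑[ i < n ] g i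
∑-mono-≤ {zero} _ = z≤n
∑-mono-≤ {suc n} f≤g = +-mono-≤ (f≤g zero) (∑-mono-≤ (f≤g ∘ suc))

∑-const : ∀ n c → ∑[ i < n ] c ≡ n * c
∑-const zero c = refl
∑-const (suc n) c = cong (c +_) (∑-const n c)

∑-positive : ∀ {n} (f : Fin n → ℕ) → 0 < ∑[ i < n ] f i → ∃ λ i → 0 < f i
∑-positive {suc n} f pos with f zero in eq
... | suc _ = zero , subst (0 <_) (≡-sym eq) (s≤s z≤n)
... | zero with ∑-positive (f ∘ suc) pos
...   | i , fi>0 = suc i , fi>0

-- Charge is conserved: the amounts sent and received cancel in the total (∑-comm).
discharging : ∀ {n} (charge : Fin n → ℕ) (send : Fin n → Fin n → ℕ) b →
  (∀ v → b + ∑[ w < n ] send v w ≤ charge v + ∑[ u < n ] send u v) →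
  n * b ≤ ∑[ v < n ] charge v
discharging {n} charge send b final≥b = +-cancelʳ-≤ moved (n * b) total (begin
  n * b + moved                                  ≡⟨ cong (_+ moved) (∑-const n b) ⟨
  ∑[ v < n ] b + moved                           ≡⟨ ∑-distrib-+ (λ _ → b) (λ v → ∑[ w < n ] send v w) ⟨
  ∑[ v < n ] (b + ∑[ w < n ] send v w)           ≤⟨ ∑-mono-≤ final≥b ⟩
  ∑[ v < n ] (charge v + ∑[ u < n ] send u v)    ≡⟨ ∑-distrib-+ charge (λ v → ∑[ u < n ] send u v) ⟩
  total + ∑[ v < n ] ∑[ u < n ] send u v         ≡⟨ cong (total +_) (∑-comm (λ v u → send u v)) ⟩
  total + moved                                  ∎)
  where
  open ≤-Reasoning
  total = ∑[ v < n ] charge v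
  moved = ∑[ v < n ] ∑[ w < n ] send v w

module _ {a p} {A : Set a} {P : Pred A p} (P? : Decidable P) where

  length-filter-tabulate : ∀ {n} (f : Fin n → A) →
    length (filter P? (tabulate f)) ≡ ∑[ i < n ] 𝟙 (P? (f i))
  length-filter-tabulate {zero} f = refl
  length-filter-tabulate {suc n} f with P? (f zero)
  ... | yes _ = cong suc (length-filter-tabulate (f ∘ suc))
  ... | no _ = length-filter-tabulate (f ∘ suc)

module _ {a b p} {A : Set a} {B : Set b} {P : Pred (A × B) p} (P? : Decidable P) where

  length-filter-cartesianProduct : ∀ {m n} (f : Fin m → A) (g : Fin n → B) →
    length (filter P? (cartesianProduct (tabulate f) (tabulate g)))
      ≡ ∑[ i < m ] ∑[ j < n ] 𝟙 (P? (f i , g j))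
  length-filter-cartesianProduct {zero} f g = refl
  length-filter-cartesianProduct {suc m} f g = begin
    length (filter P? (row ++ rest))                ≡⟨ cong length (filter-++ P? row rest) ⟩
    length (filter P? row ++ filter P? rest)        ≡⟨ length-++ (filter P? row) ⟩
    length (filter P? row) + length (filter P? rest)
      ≡⟨ cong₂ _+_ (trans (cong (length ∘ filter P?) (map-tabulate g (f zero ,_)))
                          (length-filter-tabulate P? (λ j → f zero , g j)))
                   (length-filter-cartesianProduct (f ∘ suc) g) ⟩
    ∑[ j < _ ] 𝟙 (P? (f zero , g j)) + ∑[ i < m ] ∑[ j < _ ] 𝟙 (P? (f (suc i) , g j)) ∎
    where
    open ≡-Reasoning
    row = map (f zero ,_) (tabulate g)
    rest = cartesianProduct (tabulate (f ∘ suc)) (tabulate g)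

module _ (G : Graph) where

  private
    N = n G

  a : Fin N → Fin N → ℕ
  a v w = 𝟙 (T? (adj G v w))

  a-sym : ∀ v w → a v w ≡ a w v
  a-sym v w = cong (λ b → if b then 1 else 0) (Graph.sym G v w)

  deg≡∑ : ∀ v → deg G v ≡ ∑[ w < N ] a v w
  deg≡∑ v = length-filter-tabulate (λ w → T? (adj G v w)) (λ w → w)

  nbrsDegAtMost≡∑ : ∀ v k → nbrsDegAtMost G v k ≡ ∑[ w < N ] (a v w * 𝟙 (deg G w ≤? k))
  nbrsDegAtMost≡∑ v k = trans (length-filter-tabulate (λ w → T? (adj G v w) ×-dec (deg G w ≤? k)) (λ w → w))
    (sum-cong-≗ (λ w → 𝟙-×-dec (T? (adj G v w)) (deg G w ≤? k)))

  a-split : ∀ u w → a u w ≡ a u w * 𝟙 (toℕ u <? toℕ w) + a w u * 𝟙 (toℕ w <? toℕ u)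
  a-split u w with <-cmp (toℕ u) (toℕ w)
  ... | tri< u<w _ w≮u
    rewrite 𝟙-yes (toℕ u <? toℕ w) u<w | 𝟙-no (toℕ w <? toℕ u) w≮u
    = ≡-sym (trans (cong₂ _+_ (*-identityʳ (a u w)) (*-zeroʳ (a w u))) (+-identityʳ (a u w)))
  ... | tri> u≮w _ w<u
    rewrite 𝟙-no (toℕ u <? toℕ w) u≮w | 𝟙-yes (toℕ w <? toℕ u) w<u
    = trans (a-sym u w) (≡-sym (cong₂ _+_ (*-zeroʳ (a u w)) (*-identityʳ (a w u))))
  ... | tri≈ _ u≡w _ rewrite toℕ-injective u≡w | irrefl G w = refl

  eG≡∑ : eG G ≡ ∑[ u < N ] ∑[ w < N ] (a u w * 𝟙 (toℕ u <? toℕ w))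
  eG≡∑ = trans (length-filter-cartesianProduct edge? (λ u → u) (λ w → w))
    (sum-cong-≗ λ u → sum-cong-≗ λ w → 𝟙-×-dec (T? (adj G u w)) (toℕ u <? toℕ w))
    where
    edge? : (e : Fin N × Fin N) → Dec (Adj G (proj₁ e) (proj₂ e) × toℕ (proj₁ e) < toℕ (proj₂ e))
    edge? e = T? (adj G (proj₁ e) (proj₂ e)) ×-dec (toℕ (proj₁ e) <? toℕ (proj₂ e))

  handshake : ∑[ v < N ] deg G v ≡ eG G + eG G
  handshake = begin
    ∑[ u < N ] deg G u
      ≡⟨ sum-cong-≗ (λ u → trans (deg≡∑ u) (sum-cong-≗ (a-split u))) ⟩
    ∑[ u < N ] ∑[ w < N ] (forward u w + forward w u)
      ≡⟨ sum-cong-≗ (λ u → ∑-distrib-+ (forward u) (λ w → forward w u)) ⟩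
    ∑[ u < N ] (∑[ w < N ] forward u w + ∑[ w < N ] forward w u)
      ≡⟨ ∑-distrib-+ (λ u → ∑[ w < N ] forward u w) _ ⟩
    E + ∑[ u < N ] ∑[ w < N ] forward w u
      ≡⟨ cong (E +_) (∑-comm (λ u w → forward w u)) ⟩
    E + E
      ≡⟨ ≡-sym (cong₂ _+_ eG≡∑ eG≡∑) ⟩
    eG G + eG G ∎
    where
    open ≡-Reasoning
    forward : Fin N → Fin N → ℕ
    forward u w = a u w * 𝟙 (toℕ u <? toℕ w)
    E = ∑[ u < N ] ∑[ w < N ] forward u w

share : ℕ → ℕ
share 4 = 12
share 5 = 9
share 6 = 8
share 7 = 6
share _ = 0

share≤12 : ∀ x → share x ≤ 12 * 𝟙 (x ≤? 7)
share≤12 0 = z≤n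
share≤12 1 = z≤n
share≤12 2 = z≤n
share≤12 3 = z≤n
share≤12 4 = ≤-refl
share≤12 5 = m≤m+n 9 3
share≤12 6 = m≤m+n 8 4
share≤12 7 = m≤m+n 6 6
share≤12 (suc (suc (suc (suc (suc (suc (suc (suc x)))))))) = z≤n

share≤9 : ∀ x → ¬ x ≡ 4 → share x ≤ 9 * 𝟙 (x ≤? 7)
share≤9 0 _ = z≤n
share≤9 1 _ = z≤n
share≤9 2 _ = z≤n
share≤9 3 _ = z≤n
share≤9 4 x≢4 = ⊥-elim (x≢4 refl)
share≤9 5 _ = ≤-refl
share≤9 6 _ = m≤m+n 8 1
share≤9 7 _ = m≤m+n 6 3
share≤9 (suc (suc (suc (suc (suc (suc (suc (suc x)))))))) _ = z≤n

slack-of-∸ : ∀ {d k} j → j ≤ d → ¬ d ∸ j ≤ k → k + suc j ≤ d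
slack-of-∸ {d} {k} j j≤d ¬d∸j≤k =
  subst (_≤ d) (≡-sym (+-suc k j)) (m≤o∸n⇒m+n≤o (suc k) j≤d (≰⇒> ¬d∸j≤k))

surplus : ∀ {d k} j lo → k + j ≤ d → lo ≤ d → 96 ≤ 9 * j + 3 * lo → 96 + 9 * k ≤ 12 * d
surplus {d} {k} j lo k+j≤d lo≤d 96≤ = begin
  96 + 9 * k               ≤⟨ +-monoˡ-≤ (9 * k) (≤-trans 96≤ (+-monoʳ-≤ (9 * j) (*-monoʳ-≤ 3 lo≤d))) ⟩
  9 * j + 3 * d + 9 * k    ≡⟨ regroup j d k ⟩
  9 * (k + j) + 3 * d      ≤⟨ +-monoˡ-≤ (3 * d) (*-monoʳ-≤ 9 k+j≤d) ⟩
  9 * d + 3 * d            ≡⟨ nine+three d ⟩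
  12 * d                   ∎
  where
  open ≤-Reasoning
  regroup : ∀ j d k → 9 * j + 3 * d + 9 * k ≡ 9 * (k + j) + 3 * d
  regroup = solve-∀
  nine+three : ∀ d → 9 * d + 3 * d ≡ 12 * d
  nine+three = solve-∀

large-degree-surplus : ∀ {d k} → 20 ≤ d → k ≤ d →
  ¬ (20 ≤ d × d ≤ 22 × d ∸ 3 ≤ k) → ¬ (23 ≤ d × d ≤ 25 × d ∸ 2 ≤ k) →
  ¬ (26 ≤ d × d ≤ 28 × d ∸ 1 ≤ k) → ¬ (29 ≤ d × d ≤ 31 × d ≤ k) →
  96 + 9 * k ≤ 12 * d
large-degree-surplus {d} {k} 20≤d k≤d ¬c₅ ¬c₆ ¬c₇ ¬c₈
  with d ≤? 22 | d ≤? 25 | d ≤? 28 | d ≤? 31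
... | yes d≤22 | _ | _ | _ =
  surplus 4 20 (slack-of-∸ 3 (m+n≤o⇒m≤o 3 {17} 20≤d) λ p → ¬c₅ (20≤d , d≤22 , p)) 20≤d ≤-refl
... | no d≰22 | yes d≤25 | _ | _ =
  surplus 3 23 (slack-of-∸ 2 (m+n≤o⇒m≤o 2 {18} 20≤d) λ p → ¬c₆ (≰⇒> d≰22 , d≤25 , p))
    (≰⇒> d≰22) ≤-refl
... | no _ | no d≰25 | yes d≤28 | _ =
  surplus 2 26 (slack-of-∸ 1 (m+n≤o⇒m≤o 1 {19} 20≤d) λ p → ¬c₇ (≰⇒> d≰25 , d≤28 , p))
    (≰⇒> d≰25) ≤-refl
... | no _ | no _ | no d≰28 | yes d≤31 =
  surplus 1 29 (slack-of-∸ 0 z≤n λ p → ¬c₈ (≰⇒> d≰28 , d≤31 , p)) (≰⇒> d≰28) ≤-refl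
... | no _ | no _ | no _ | no d≰31 =
  surplus 0 32 (subst (_≤ d) (≡-sym (+-identityʳ k)) k≤d) (≰⇒> d≰31) ≤-refl

surplus-with-4-neighbour : ∀ {d k} → 20 ≤ d → ¬ d ∸ 7 ≤ k → 96 + 12 * k ≤ 12 * d
surplus-with-4-neighbour {d} {k} 20≤d ¬c₉ =
  subst (_≤ 12 * d) (expand k) (*-monoʳ-≤ 12 (slack-of-∸ 7 (m+n≤o⇒m≤o 7 {13} 20≤d) ¬c₉))
  where
  expand : ∀ k → 12 * (k + 8) ≡ 96 + 12 * k
  expand = solve-∀

m+n≡o+p∧p≤n⇒m≤o : ∀ {m k} c t → c + t ≡ m + k → k ≤ t → c ≤ m
m+n≡o+p∧p≤n⇒m≤o {m} {k} c t eq k≤t =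
  +-cancelʳ-≤ t c m (subst (_≤ m + t) (≡-sym eq) (+-monoʳ-≤ m k≤t))

small-degree-surplus : ∀ {d m k} → d ≡ m + k → 4 ≤ d →
  ¬ (d ≡ 4 × 1 ≤ k) → ¬ (d ≡ 5 × 2 ≤ k) → ¬ (d ≡ 6 × 4 ≤ k) → ¬ (d ≡ 7 × 6 ≤ k) →
  96 ≤ 12 * d + share d * m
small-degree-surplus {4} eq _ ¬c₁ _ _ _ =
  +-monoʳ-≤ 48 (*-monoʳ-≤ 12 (m+n≡o+p∧p≤n⇒m≤o 4 0 eq (≤-pred (≰⇒> λ p → ¬c₁ (refl , p)))))
small-degree-surplus {5} eq _ _ ¬c₂ _ _ =
  +-monoʳ-≤ 60 (*-monoʳ-≤ 9 (m+n≡o+p∧p≤n⇒m≤o 4 1 eq (≤-pred (≰⇒> λ p → ¬c₂ (refl , p)))))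
small-degree-surplus {6} eq _ _ _ ¬c₃ _ =
  +-monoʳ-≤ 72 (*-monoʳ-≤ 8 (m+n≡o+p∧p≤n⇒m≤o 3 3 eq (≤-pred (≰⇒> λ p → ¬c₃ (refl , p)))))
small-degree-surplus {7} eq _ _ _ _ ¬c₄ =
  +-monoʳ-≤ 84 (*-monoʳ-≤ 6 (m+n≡o+p∧p≤n⇒m≤o 2 5 eq (≤-pred (≰⇒> λ p → ¬c₄ (refl , p)))))
small-degree-surplus {d@(suc (suc (suc (suc (suc (suc (suc (suc x))))))))} {m} _ _ _ _ _ _ =
  ≤-trans (*-monoʳ-≤ 12 (m≤m+n 8 x)) (m≤m+n (12 * d) (share d * m))
small-degree-surplus {0} _ ()
small-degree-surplus {1} _ (s≤s ())
small-degree-surplus {2} _ (s≤s (s≤s ()))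
small-degree-surplus {3} _ (s≤s (s≤s (s≤s ())))

too-few-edges : ∀ {e n} → e + 1 ≤ 4 * n → n * 96 ≤ 12 * (e + e) → ⊥
too-few-edges {e} {n} e<4n 96n≤24e = 24≰0 (+-cancelˡ-≤ (24 * e) 24 0 (begin
  24 * e + 24       ≡⟨ expand e ⟩
  24 * (e + 1)      ≤⟨ *-monoʳ-≤ 24 e<4n ⟩
  24 * (4 * n)      ≡⟨ reassoc n ⟩
  n * 96            ≤⟨ 96n≤24e ⟩
  12 * (e + e)      ≡⟨ double e ⟩
  24 * e + 0        ∎))
  where
  open ≤-Reasoning
  24≰0 : ¬ 24 ≤ 0
  24≰0 ()
  expand : ∀ e → 24 * e + 24 ≡ 24 * (e + 1)
  expand = solve-∀
  reassoc : ∀ n → 24 * (4 * n) ≡ n * 96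
  reassoc = solve-∀
  double : ∀ e → 12 * (e + e) ≡ 24 * e + 0
  double = solve-∀

module _ (G : Graph) where

  private
    N = n G

  C₁ C₂ C₃ C₄ C₅ C₆ C₇ C₈ C₉ : Set
  C₁ = Σ (Fin N) λ v → Σ (Fin N) λ u → deg G v ≡ 4 × Adj G v u × deg G u ≤ 19
  C₂ = Σ (Fin N) λ v → deg G v ≡ 5 × 2 ≤ nbrsDegAtMost G v 19
  C₃ = Σ (Fin N) λ v → deg G v ≡ 6 × 4 ≤ nbrsDegAtMost G v 19
  C₄ = Σ (Fin N) λ v → deg G v ≡ 7 × 6 ≤ nbrsDegAtMost G v 19
  C₅ = Σ (Fin N) λ v → 20 ≤ deg G v × deg G v ≤ 22 × deg G v ∸ 3 ≤ nbrsDegAtMost G v 7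
  C₆ = Σ (Fin N) λ v → 23 ≤ deg G v × deg G v ≤ 25 × deg G v ∸ 2 ≤ nbrsDegAtMost G v 7
  C₇ = Σ (Fin N) λ v → 26 ≤ deg G v × deg G v ≤ 28 × deg G v ∸ 1 ≤ nbrsDegAtMost G v 7
  C₈ = Σ (Fin N) λ v → 29 ≤ deg G v × deg G v ≤ 31 × deg G v ≤ nbrsDegAtMost G v 7
  C₉ = Σ (Fin N) λ v → deg G v ∸ 7 ≤ nbrsDegAtMost G v 7
         × Σ (Fin N) λ u → Adj G v u × deg G u ≡ 4

  C₁? : Dec C₁
  C₁? = any? λ v → any? λ u → (deg G v ≟ 4) ×-dec T? (adj G v u) ×-dec (deg G u ≤? 19)
  C₂? : Dec C₂
  C₂? = any? λ v → (deg G v ≟ 5) ×-dec (2 ≤? nbrsDegAtMost G v 19)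
  C₃? : Dec C₃
  C₃? = any? λ v → (deg G v ≟ 6) ×-dec (4 ≤? nbrsDegAtMost G v 19)
  C₄? : Dec C₄
  C₄? = any? λ v → (deg G v ≟ 7) ×-dec (6 ≤? nbrsDegAtMost G v 19)
  C₅? : Dec C₅
  C₅? = any? λ v → (20 ≤? deg G v) ×-dec (deg G v ≤? 22) ×-dec (deg G v ∸ 3 ≤? nbrsDegAtMost G v 7)
  C₆? : Dec C₆
  C₆? = any? λ v → (23 ≤? deg G v) ×-dec (deg G v ≤? 25) ×-dec (deg G v ∸ 2 ≤? nbrsDegAtMost G v 7)
  C₇? : Dec C₇
  C₇? = any? λ v → (26 ≤? deg G v) ×-dec (deg G v ≤? 28) ×-dec (deg G v ∸ 1 ≤? nbrsDegAtMost G v 7)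
  C₈? : Dec C₈
  C₈? = any? λ v → (29 ≤? deg G v) ×-dec (deg G v ≤? 31) ×-dec (deg G v ≤? nbrsDegAtMost G v 7)
  C₉? : Dec C₉
  C₉? = any? λ v → (deg G v ∸ 7 ≤? nbrsDegAtMost G v 7) ×-dec
          any? (λ u → T? (adj G v u) ×-dec (deg G u ≟ 4))

  nbrsDegAtMost≤deg : ∀ v k → nbrsDegAtMost G v k ≤ deg G v
  nbrsDegAtMost≤deg v k = subst₂ _≤_ (≡-sym (nbrsDegAtMost≡∑ G v k)) (≡-sym (deg≡∑ G v))
    (∑-mono-≤ λ w → subst (a G v w * 𝟙 (deg G w ≤? k) ≤_) (*-identityʳ (a G v w))
                          (*-monoʳ-≤ (a G v w) (𝟙≤1 (deg G w ≤? k))))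

  nbrsDegAtMost-witness : ∀ v k → 1 ≤ nbrsDegAtMost G v k → Σ (Fin N) λ u → Adj G v u × deg G u ≤ k
  nbrsDegAtMost-witness v k pos =
    let u , 0<𝟙 = ∑-positive _ (subst (1 ≤_) (length-filter-tabulate P? (λ w → w)) pos)
    in u , 𝟙-positive (P? u) 0<𝟙
    where
    P? = λ w → T? (adj G v w) ×-dec (deg G w ≤? k)

  weighted-nbrs-≤ : ∀ v k c (f : Fin N → ℕ) → (∀ w → Adj G v w → f w ≤ c * 𝟙 (deg G w ≤? k)) →
    ∑[ w < N ] (a G v w * f w) ≤ c * nbrsDegAtMost G v k
  weighted-nbrs-≤ v k c f bound = begin
    ∑[ w < N ] (a G v w * f w)                     ≤⟨ ∑-mono-≤ (λ w → 𝟙-*-mono c (T? (adj G v w)) (bound w)) ⟩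
    ∑[ w < N ] (c * (a G v w * 𝟙 (deg G w ≤? k)))   ≡⟨ *-distribˡ-sum c (λ w → a G v w * 𝟙 (deg G w ≤? k)) ⟨
    c * ∑[ w < N ] (a G v w * 𝟙 (deg G w ≤? k))     ≡⟨ cong (c *_) (nbrsDegAtMost≡∑ G v k) ⟨
    c * nbrsDegAtMost G v k                         ∎
    where open ≤-Reasoning

  send : Fin N → Fin N → ℕ
  send v w = 𝟙 (20 ≤? deg G v) * (a G v w * share (deg G w))

  largeNbrs : Fin N → ℕ
  largeNbrs v = ∑[ u < N ] (a G v u * 𝟙 (20 ≤? deg G u))

  sent-by-large : ∀ v → 20 ≤ deg G v → ∑[ w < N ] send v w ≡ ∑[ w < N ] (a G v w * share (deg G w))
  sent-by-large v large = sum-cong-≗ λ w →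
    trans (cong (_* (a G v w * share (deg G w))) (𝟙-yes (20 ≤? deg G v) large)) (*-identityˡ _)

  sent-by-small : ∀ v → ¬ 20 ≤ deg G v → ∑[ w < N ] send v w ≡ 0
  sent-by-small v small = trans
    (sum-cong-≗ λ w → cong (_* (a G v w * share (deg G w))) (𝟙-no (20 ≤? deg G v) small))
    (trans (∑-const N 0) (*-zeroʳ N))

  received : ∀ v → ∑[ u < N ] send u v ≡ share (deg G v) * largeNbrs v
  received v = trans (sum-cong-≗ λ u → trans (swap (𝟙 (20 ≤? deg G u)) (a G u v) s)
                                              (cong (λ x → s * (x * 𝟙 (20 ≤? deg G u))) (a-sym G u v)))
                     (≡-sym (*-distribˡ-sum s (λ u → a G v u * 𝟙 (20 ≤? deg G u))))
    where
    s = share (deg G v)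
    swap : ∀ x y z → x * (y * z) ≡ z * (y * x)
    swap = solve-∀

  deg≡largeNbrs+nbrsDegAtMost19 : ∀ v → deg G v ≡ largeNbrs v + nbrsDegAtMost G v 19
  deg≡largeNbrs+nbrsDegAtMost19 v = begin
    deg G v                               ≡⟨ deg≡∑ G v ⟩
    ∑[ u < N ] a G v u                    ≡⟨ sum-cong-≗ split ⟩
    ∑[ u < N ] (large u + low u)          ≡⟨ ∑-distrib-+ large low ⟩
    largeNbrs v + ∑[ u < N ] low u        ≡⟨ cong (largeNbrs v +_) (nbrsDegAtMost≡∑ G v 19) ⟨
    largeNbrs v + nbrsDegAtMost G v 19    ∎
    where
    open ≡-Reasoning
    large low : Fin N → ℕ
    large u = a G v u * 𝟙 (20 ≤? deg G u)
    low u = a G v u * 𝟙 (deg G u ≤? 19)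
    split : ∀ u → a G v u ≡ large u + low u
    split u = begin
      a G v u                                             ≡⟨ *-identityʳ _ ⟨
      a G v u * 1                                         ≡⟨ cong (a G v u *_) complement ⟨
      a G v u * (𝟙 (20 ≤? deg G u) + 𝟙 (deg G u ≤? 19))   ≡⟨ *-distribˡ-+ (a G v u) _ _ ⟩
      large u + low u                                     ∎
      where
      complement : 𝟙 (20 ≤? deg G u) + 𝟙 (deg G u ≤? 19) ≡ 1
      complement = 𝟙-complement (20 ≤? deg G u) (deg G u ≤? 19) <⇒≱ (≤-pred ∘ ≰⇒>)

module NoConfiguration (G : Graph) (δ≥4 : MinDegAtLeast G 4)
  (¬c₁ : ¬ C₁ G) (¬c₂ : ¬ C₂ G) (¬c₃ : ¬ C₃ G) (¬c₄ : ¬ C₄ G) (¬c₅ : ¬ C₅ G)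
  (¬c₆ : ¬ C₆ G) (¬c₇ : ¬ C₇ G) (¬c₈ : ¬ C₈ G) (¬c₉ : ¬ C₉ G) where

  private
    N = n G

  large-vertex : ∀ v → 20 ≤ deg G v → 96 + ∑[ w < N ] send G v w ≤ 12 * deg G v
  large-vertex v 20≤d rewrite sent-by-large G v 20≤d
    with any? (λ u → T? (adj G v u) ×-dec (deg G u ≟ 4))
  ... | yes (u , vu , d≡4) = ≤-trans
    (+-monoʳ-≤ 96 (weighted-nbrs-≤ G v 7 12 _ λ w _ → share≤12 (deg G w)))
    (surplus-with-4-neighbour 20≤d λ p → ¬c₉ (v , p , u , vu , d≡4))
  ... | no no-4 = ≤-trans
    (+-monoʳ-≤ 96 (weighted-nbrs-≤ G v 7 9 _ λ w vw → share≤9 (deg G w) λ d≡4 → no-4 (w , vw , d≡4)))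
    (large-degree-surplus 20≤d (nbrsDegAtMost≤deg G v 7)
      (λ p → ¬c₅ (v , p)) (λ p → ¬c₆ (v , p)) (λ p → ¬c₇ (v , p)) (λ p → ¬c₈ (v , p)))

  small-vertex : ∀ v → ¬ 20 ≤ deg G v →
    96 + ∑[ w < N ] send G v w ≤ 12 * deg G v + ∑[ u < N ] send G u v
  small-vertex v small rewrite sent-by-small G v small | received G v =
    small-degree-surplus (deg≡largeNbrs+nbrsDegAtMost19 G v) (δ≥4 v)
      ¬c₁-at-v (λ p → ¬c₂ (v , p)) (λ p → ¬c₃ (v , p)) (λ p → ¬c₄ (v , p))
    where
    ¬c₁-at-v : ¬ (deg G v ≡ 4 × 1 ≤ nbrsDegAtMost G v 19)
    ¬c₁-at-v (d≡4 , 1≤k) =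
      let u , vu , u≤19 = nbrsDegAtMost-witness G v 19 1≤k in ¬c₁ (v , u , d≡4 , vu , u≤19)

  final-charge : ∀ v → 96 + ∑[ w < N ] send G v w ≤ 12 * deg G v + ∑[ u < N ] send G u v
  final-charge v with 20 ≤? deg G v
  ... | yes large = ≤-trans (large-vertex v large) (m≤m+n _ _)
  ... | no small = small-vertex v small

  sparse-impossible : eG G + 1 ≤ 4 * vG G → ⊥
  sparse-impossible e<4v = too-few-edges {n = N} e<4v (begin
    N * 96                      ≤⟨ discharging (λ v → 12 * deg G v) (send G) 96 final-charge ⟩
    ∑[ v < N ] (12 * deg G v)   ≡⟨ *-distribˡ-sum 12 (deg G) ⟨
    12 * ∑[ v < N ] deg G v     ≡⟨ cong (12 *_) (handshake G) ⟩
    12 * (eG G + eG G)          ∎)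
    where open ≤-Reasoning

lemma3p6 : (G : Graph) → eG G + 1 ≤ 4 * vG G → MinDegAtLeast G 4 →
    (Σ (Fin (n G)) λ v → Σ (Fin (n G)) λ u → deg G v ≡ 4 × Adj G v u × deg G u ≤ 19)
    ⊎ (Σ (Fin (n G)) λ v → deg G v ≡ 5 × 2 ≤ nbrsDegAtMost G v 19)
    ⊎ (Σ (Fin (n G)) λ v → deg G v ≡ 6 × 4 ≤ nbrsDegAtMost G v 19)
    ⊎ (Σ (Fin (n G)) λ v → deg G v ≡ 7 × 6 ≤ nbrsDegAtMost G v 19)
    ⊎ (Σ (Fin (n G)) λ v → 20 ≤ deg G v × deg G v ≤ 22 × deg G v ∸ 3 ≤ nbrsDegAtMost G v 7)
    ⊎ (Σ (Fin (n G)) λ v → 23 ≤ deg G v × deg G v ≤ 25 × deg G v ∸ 2 ≤ nbrsDegAtMost G v 7)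
    ⊎ (Σ (Fin (n G)) λ v → 26 ≤ deg G v × deg G v ≤ 28 × deg G v ∸ 1 ≤ nbrsDegAtMost G v 7)
    ⊎ (Σ (Fin (n G)) λ v → 29 ≤ deg G v × deg G v ≤ 31 × deg G v ≤ nbrsDegAtMost G v 7)
    ⊎ (Σ (Fin (n G)) λ v → deg G v ∸ 7 ≤ nbrsDegAtMost G v 7
    × Σ (Fin (n G)) λ u → Adj G v u × deg G u ≡ 4)
lemma3p6 G e<4v δ≥4 =
  C₁? G or-else λ ¬c₁ →
  C₂? G or-else λ ¬c₂ →
  C₃? G or-else λ ¬c₃ →
  C₄? G or-else λ ¬c₄ →
  C₅? G or-else λ ¬c₅ →
  C₆? G or-else λ ¬c₆ →
  C₇? G or-else λ ¬c₇ →
  C₈? G or-else λ ¬c₈ →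
  decidable-stable (C₉? G) λ ¬c₉ →
  NoConfiguration.sparse-impossible G δ≥4 ¬c₁ ¬c₂ ¬c₃ ¬c₄ ¬c₅ ¬c₆ ¬c₇ ¬c₈ ¬c₉ e<4v
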